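{- For any statement $s$ and state predicates $U,Z$, if $\{U\}\,s\,\{Z\}$ is derivable in the state-based total-correctness Hoare logic with the rule while-fun, then $\{U\}\,s\,\{\mathit{finite}\ast\ast\langle Z\rangle\}$ is derivable in the trace-based Hoare logic.
   Context: While statements: $s ::= x:=e \mid \mathsf{skip}\mid s_0;s_1\mid \mathsf{if}\ e\ \mathsf{then}\ s_t\ \mathsf{else}\ s_f\mid \mathsf{while}\ e\ \mathsf{do}\ s_t$; a state $\sigma$ assigns integers to variables, $[\![e]\!]\sigma$ is the value of $e$, $\sigma\models e$ means $e$ is true in $\sigma$. The metatheory is constructive. Traces are coinductive: $\langle\sigma\rangle$, and $\sigma::\tau$ for a trace $\tau$; bisimilarity $\approx$ is coinductive; $\mathit{hd}\langle\sigma\rangle=\mathit{hd}(\sigma::\tau)=\sigma$; $\tau\downarrow\sigma$ is inductive: $\langle\sigma\rangle\downarrow\sigma$, $\sigma::\tau\downarrow\sigma'$ if $\tau\downarrow\sigma'$. State predicates are arbitrary; trace predicates are setoid predicates (invariant under $\approx$); $\mathsf{true},\wedge,\neg,\exists$ are pointwise; $\models$ is entailment; $\mathit{finite}$ holds of $\tau$ iff $\tau\downarrow\sigma$ for some $\sigma$. $\langle U\rangle$ holds exactly of $\langle\sigma\rangle$ with $\sigma\models U$; $\mathrm{dup}(U)$ exactly of $\sigma::\langle\sigma\rangle$ with $\sigma\models U$; $U[x\mapsto e]$ exactly of $\sigma::\langle\sigma[x\mapsto[\![e]\!]\sigma]\rangle$ with $\sigma\models U$. $\mathrm{follows}_Q(\tau,\tau')$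 is coinductive: $\mathrm{follows}_Q(\langle\sigma\rangle,\tau)$ if $\mathit{hd}\,\tau=\sigma$ and $\tau\models Q$; $\mathrm{follows}_Q(\sigma::\tau,\sigma::\tau')$ if $\mathrm{follows}_Q(\tau,\tau')$. $\tau'\models P\ast\ast Q$ iff $\exists\tau$, $\tau\models P$ and $\mathrm{follows}_Q(\tau,\tau')$ (chains associate to the right). $P^{\dagger}$ is coinductive: $\tau\models P^{\dagger}$ if $\tau\models\langle\mathsf{true}\rangle$; $\tau'\models P^{\dagger}$ if $\exists\tau$, $\tau\models P$ and $\mathrm{follows}_{P^{\dagger}}(\tau,\tau')$. The trace-based Hoare logic derives $\{U\}\,s\,\{P\}$ inductively by: $\{U\}\,x:=e\,\{U[x\mapsto e]\}$; $\{U\}\,\mathsf{skip}\,\{\langle U\rangle\}$; from $\{U\}\,s_0\,\{P\ast\ast\langle V\rangle\}$ and $\{V\}\,s_1\,\{Q\}$ infer $\{U\}\,s_0;s_1\,\{P\ast\ast Q\}$; from $\{e\wedge U\}\,s_t\,\{P\}$ and $\{\neg e\wedge U\}\,s_f\,\{P\}$ infer $\{U\}\,\mathsf{if}\ e\ \mathsf{then}\ s_t\ \mathsf{else}\ s_f\,\{\mathrm{dup}(U)\ast\ast P\}$; from $U\models I$ and $\{e\wedge I\}\,s_t\,\{P\ast\ast\langle I\rangle\}$ infer $\{U\}\,\mathsf{while}\ e\ \mathsf{do}\ s_t\,\{\mathrm{dup}(U)\ast\ast(P\ast\ast\mathrm{dup}(I))^{\dagger}\ast\ast\langle\neg e\rangle\}$;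 from $U\models U'$, $\{U'\}\,s\,\{P'\}$, $P'\models P$ infer $\{U\}\,s\,\{P\}$; from $\forall z.\ \{U_z\}\,s\,\{P_z\}$ infer $\{\exists z.U_z\}\,s\,\{\exists z.P_z\}$. The state-based total-correctness Hoare logic with while-fun derives $\{U\}\,s\,\{Z\}$ inductively by: $\{U[e/x]\}\,x:=e\,\{U\}$ where $U[e/x]$ holds of $\sigma$ iff $U$ holds of $\sigma[x\mapsto[\![e]\!]\sigma]$; $\{U\}\,\mathsf{skip}\,\{U\}$; from $\{U\}\,s_0\,\{V\}$, $\{V\}\,s_1\,\{Z\}$ infer $\{U\}\,s_0;s_1\,\{Z\}$; from $\{e\wedge U\}\,s_t\,\{Z\}$, $\{\neg e\wedge U\}\,s_f\,\{Z\}$ infer $\{U\}\,\mathsf{if}\ e\ \mathsf{then}\ s_t\ \mathsf{else}\ s_f\,\{Z\}$; while-fun: for a function $t$ from states to natural numbers and $m\in\mathbb{N}$, from $\forall n\in\mathbb{N}.\ \{e\wedge I\wedge t=n\}\,s_t\,\{I\wedge t<n\}$ infer $\{I\wedge t=m\}\,\mathsf{while}\ e\ \mathsf{do}\ s_t\,\{I\wedge t\le m\wedge\neg e\}$; from $\forall z.\{U_z\}\,s\,\{V_z\}$ infer $\{\exists z.U_z\}\,s\,\{\exists z.V_z\}$; from $U\models U'$, $\{U'\}\,s\,\{Z'\}$, $Z'\models Z$ infer $\{U\}\,s\,\{Z\}$. -}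

module Defs where

open import Level using (Level; _⊔_) renaming (suc to lsuc; zero to lzero)
open import Data.Nat using (ℕ; zero; suc; _≡ᵇ_; _<_; _≤_)
open import Data.Integer using (ℤ; 0ℤ; 1ℤ; _≟_; _≤?_; _<?_) renaming (_+_ to _+ℤ_; _-_ to _-ℤ_; _*_ to _*ℤ_)
open import Data.Bool using (if_then_else_)
open import Data.Maybe using (Maybe; just; nothing)
open import Data.Product using (Σ; _×_; _,_; proj₁; proj₂)
open import Data.Sum using (_⊎_; inj₁; inj₂)
open import Relation.Nullary using (¬_; yes; no)
open import Relation.Binary.PropositionalEquality using (_≡_; _≢_; refl; sym; trans; cong)

Var : Set
Var = ℕ

State : Set
State = Var → ℤ

data Expr : Set where
  lit       : ℤ → Expr
  var       : Var → Expr
  _⊕_ _⊖_ _⊗_ : Expr → Expr → Expr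
  _≐_ _≺_   : Expr → Expr → Expr
  !_        : Expr → Expr

⟦_⟧ : Expr → State → ℤ
⟦ lit n ⟧ σ = n
⟦ var x ⟧ σ = σ x
⟦ e₁ ⊕ e₂ ⟧ σ = ⟦ e₁ ⟧ σ +ℤ ⟦ e₂ ⟧ σ
⟦ e₁ ⊖ e₂ ⟧ σ = ⟦ e₁ ⟧ σ -ℤ ⟦ e₂ ⟧ σ
⟦ e₁ ⊗ e₂ ⟧ σ = ⟦ e₁ ⟧ σ *ℤ ⟦ e₂ ⟧ σ
⟦ e₁ ≐ e₂ ⟧ σ with ⟦ e₁ ⟧ σ ≟ ⟦ e₂ ⟧ σ
... | yes _ = 1ℤ
... | no  _ = 0ℤ
⟦ e₁ ≺ e₂ ⟧ σ with ⟦ e₁ ⟧ σ <? ⟦ e₂ ⟧ σ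
... | yes _ = 1ℤ
... | no  _ = 0ℤ
⟦ ! e ⟧ σ with ⟦ e ⟧ σ ≟ 0ℤ
... | yes _ = 1ℤ
... | no  _ = 0ℤ

_⊨_ : State → Expr → Set
σ ⊨ e = ⟦ e ⟧ σ ≢ 0ℤ

_[_↦_] : State → Var → ℤ → State
(σ [ x ↦ v ]) y = if x ≡ᵇ y then v else σ y

data Stmt : Set where
  _≔_             : Var → Expr → Stmt
  skip            : Stmt
  _⨾_             : Stmt → Stmt → Stmt
  If_Then_Else_   : Expr → Stmt → Stmt → Stmt
  While_Do_       : Expr → Stmt → Stmt

Assn : Set₁
Assn = State → Set

⌜_⌝ : Expr → Assn
⌜ e ⌝ σ = σ ⊨ e

∼_ : Expr → Assn
(∼ e) σ = ¬ (σ ⊨ e)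

_∧ₐ_ : Assn → Assn → Assn
(U ∧ₐ V) σ = U σ × V σ

∃ₐ : (A : Set) → (A → Assn) → Assn
∃ₐ A U σ = Σ A (λ z → U z σ)

_⊨ₐ_ : Assn → Assn → Set
U ⊨ₐ V = ∀ σ → U σ → V σ

_[_/_] : Assn → Expr → Var → Assn
(U [ e / x ]) σ = U (σ [ x ↦ ⟦ e ⟧ σ ])

-- Traces: non-empty, possibly infinite sequences of states.
-- Encoded as a head state
-- followed by a prefix-closed partial sequence of further states.

record Trace : Set where
  field
    hd     : State
    tl     : ℕ → Maybe State
    closed : ∀ n → tl n ≡ nothing → tl (suc n) ≡ nothing
open Trace public

⟨_⟩ : State → Trace
⟨ σ ⟩ = record { hd = σ ; tl = λ _ → nothing ; closed = λ _ _ → refl }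

private
  consTl : Trace → ℕ → Maybe State
  consTl τ zero    = just (hd τ)
  consTl τ (suc n) = tl τ n

  consClosed : (τ : Trace) → ∀ n → consTl τ n ≡ nothing → consTl τ (suc n) ≡ nothing
  consClosed τ zero    ()
  consClosed τ (suc n) p = closed τ n p

_∷_ : State → Trace → Trace
σ ∷ τ = record { hd = σ ; tl = consTl τ ; closed = consClosed τ }
infixr 5 _∷_

-- bisimilarity (for this encoding: equality of all observations)
record _≈_ (τ τ' : Trace) : Set where
  constructor bisim
  field
    hd≈ : hd τ ≡ hd τ'
    tl≈ : ∀ n → tl τ n ≡ tl τ' n
open _≈_ public

≈-refl : ∀ {τ} → τ ≈ τ
≈-refl = bisim refl (λ _ → refl)

≈-sym : ∀ {τ τ'} → τ ≈ τ' → τ' ≈ τ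
≈-sym (bisim h t) = bisim (sym h) (λ n → sym (t n))

≈-trans : ∀ {τ τ' τ''} → τ ≈ τ' → τ' ≈ τ'' → τ ≈ τ''
≈-trans (bisim h t) (bisim h' t') = bisim (trans h h') (λ n → trans (t n) (t' n))

-- τ ↓ σ (inductive; constructor patterns read up to bisimilarity)
data _↓_ (τ : Trace) (σ : State) : Set where
  ↓-nil  : τ ≈ ⟨ σ ⟩ → τ ↓ σ
  ↓-cons : ∀ {σ' τ'} → τ ≈ (σ' ∷ τ') → τ' ↓ σ → τ ↓ σ

↓-inv : ∀ {τ τ' σ} → τ ≈ τ' → τ ↓ σ → τ' ↓ σ
↓-inv e (↓-nil p)    = ↓-nil (≈-trans (≈-sym e) p)
↓-inv e (↓-cons p d) = ↓-cons (≈-trans (≈-sym e) p) d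

record TPred : Set₂ where
  field
    pred : Trace → Set₁
    inv  : ∀ {τ τ'} → τ ≈ τ' → pred τ → pred τ'
open TPred public

_⊨ₜ_ : TPred → TPred → Set₁
P ⊨ₜ Q = ∀ τ → pred P τ → pred Q τ

∃ₜ : (A : Set) → (A → TPred) → TPred
∃ₜ A P = record
  { pred = λ τ → Σ A (λ z → pred (P z) τ)
  ; inv  = λ e (z , p) → z , inv (P z) e p }

finite : TPred
finite = record
  { pred = λ τ → Level.Lift (lsuc lzero) (Σ State (λ σ → τ ↓ σ))
  ; inv  = λ e (Level.lift (σ , d)) → Level.lift (σ , ↓-inv e d) }

⟨_⟩ₜ : Assn → TPred
⟨ U ⟩ₜ = record
  { pred = λ τ → Level.Lift (lsuc lzero) (Σ State (λ σ → U σ × τ ≈ ⟨ σ ⟩))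
  ; inv  = λ e (Level.lift (σ , u , p)) → Level.lift (σ , u , ≈-trans (≈-sym e) p) }

dup : Assn → TPred
dup U = record
  { pred = λ τ → Level.Lift (lsuc lzero) (Σ State (λ σ → U σ × τ ≈ (σ ∷ ⟨ σ ⟩)))
  ; inv  = λ e (Level.lift (σ , u , p)) → Level.lift (σ , u , ≈-trans (≈-sym e) p) }

_[_↦ₜ_] : Assn → Var → Expr → TPred
U [ x ↦ₜ e ] = record
  { pred = λ τ → Level.Lift (lsuc lzero) (Σ State (λ σ → U σ × τ ≈ (σ ∷ ⟨ σ [ x ↦ ⟦ e ⟧ σ ] ⟩)))
  ; inv  = λ e' (Level.lift (σ , u , p)) → Level.lift (σ , u , ≈-trans (≈-sym e') p) }

-- follows_Q : coinductive, encoded as the greatest fixed point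
-- (union of all post-fixed points) of its defining clauses.

-- one unfolding of the two clauses of follows_Q, with R for the recursive call
FollowsStep : ∀ {ℓ} → (Trace → Set ℓ) → (Trace → Trace → Set) → Trace → Trace → Set ℓ
FollowsStep Q R τ τ' =
    Σ State (λ σ → τ ≈ ⟨ σ ⟩ × hd τ' ≡ σ × Q τ')
  ⊎ Σ State (λ σ → Σ Trace (λ t → Σ Trace (λ t' → τ ≈ (σ ∷ t) × τ' ≈ (σ ∷ t') × R t t')))

Follows : ∀ {ℓ} → (Trace → Set ℓ) → Trace → Trace → Set (lsuc lzero ⊔ ℓ)
Follows Q τ τ' =
  Σ (Trace → Trace → Set) (λ R → (∀ t t' → R t t' → FollowsStep Q R t t') × R τ τ')

Follows-mono : ∀ {ℓ ℓ'} {Q : Trace → Set ℓ} {Q' : Trace → Set ℓ'} →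
  (∀ τ → Q τ → Q' τ) → ∀ {τ τ'} → Follows Q τ τ' → Follows Q' τ τ'
Follows-mono {Q' = Q'} f (R , post , r) = R , post' , r
  where
  post' : ∀ t t' → R t t' → FollowsStep Q' R t t'
  post' t t' x with post t t' x
  ... | inj₁ (σ , a , b , q) = inj₁ (σ , a , b , f t' q)
  ... | inj₂ y = inj₂ y

Follows-inv : ∀ {ℓ} {Q : Trace → Set ℓ} →
  (∀ {τ τ'} → τ ≈ τ' → Q τ → Q τ') →
  ∀ {τ τ' τ''} → τ' ≈ τ'' → Follows Q τ τ' → Follows Q τ τ''
Follows-inv {Q = Q} Qinv {τ} {τ'} {τ''} e (R , post , r) = R' , post' , (τ' , r , e)
  where
  R' : Trace → Trace → Set
  R' t t'' = Σ Trace (λ t' → R t t' × t' ≈ t'')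
  post' : ∀ t t'' → R' t t'' → FollowsStep Q R' t t''
  post' t t'' (t' , x , e') with post t t' x
  ... | inj₁ (σ , a , b , q) = inj₁ (σ , a , trans (sym (hd≈ e')) b , Qinv e' q)
  ... | inj₂ (σ , u , u' , a , b , y) = inj₂ (σ , u , u' , a , ≈-trans (≈-sym e') b , (u' , y , ≈-refl))

_**_ : TPred → TPred → TPred
P ** Q = record
  { pred = λ τ' → Σ Trace (λ τ → pred P τ × Follows (pred Q) τ τ')
  ; inv  = λ e (τ , p , f) → τ , p , Follows-inv (inv Q) e f }
infixr 4 _**_

-- P† : coinductive, encoded as the greatest fixed point of
--   X ↦ ⟨true⟩ ∪ { τ' | ∃ τ. τ ⊨ P ∧ follows_X(τ, τ') }

DagStep : TPred → (Trace → Set) → Trace → Set₁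
DagStep P X τ' =
    Level.Lift (lsuc lzero) (Σ State (λ σ → τ' ≈ ⟨ σ ⟩))
  ⊎ Σ Trace (λ τ → pred P τ × Follows X τ τ')

Dag : TPred → Trace → Set₁
Dag P τ = Σ (Trace → Set) (λ X → (∀ t → X t → DagStep P X t) × X τ)

Dag-inv : ∀ P {τ τ'} → τ ≈ τ' → Dag P τ → Dag P τ'
Dag-inv P {τ} e (X , post , x) = X' , post' , (τ , x , e)
  where
  X' : Trace → Set
  X' t' = Σ Trace (λ t → X t × t ≈ t')
  X'inv : ∀ {a b} → a ≈ b → X' a → X' b
  X'inv e₁ (t , y , e₂) = t , y , ≈-trans e₂ e₁
  post' : ∀ t' → X' t' → DagStep P X' t'
  post' t' (t , y , e') with post t y
  ... | inj₁ (Level.lift (σ , p)) = inj₁ (Level.lift (σ , ≈-trans (≈-sym e') p))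
  ... | inj₂ (τ₀ , p , f) =
    inj₂ (τ₀ , p , Follows-inv X'inv e' (Follows-mono {Q = X} {Q' = X'} (λ a z → a , z , ≈-refl) f))

_† : TPred → TPred
P † = record { pred = Dag P ; inv = Dag-inv P }

data TH : Assn → Stmt → TPred → Set₂ where
  assign : ∀ {U x e} → TH U (x ≔ e) (U [ x ↦ₜ e ])
  skip   : ∀ {U} → TH U skip ⟨ U ⟩ₜ
  seq    : ∀ {U V s₀ s₁ P Q} →
           TH U s₀ (P ** ⟨ V ⟩ₜ) → TH V s₁ Q → TH U (s₀ ⨾ s₁) (P ** Q)
  if     : ∀ {U e sₜ s_f P} →
           TH (⌜ e ⌝ ∧ₐ U) sₜ P → TH ((∼ e) ∧ₐ U) s_f P →
           TH U (If e Then sₜ Else s_f) (dup U ** P)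
  while  : ∀ {U I e sₜ P} → U ⊨ₐ I →
           TH (⌜ e ⌝ ∧ₐ I) sₜ (P ** ⟨ I ⟩ₜ) →
           TH U (While e Do sₜ) (dup U ** ((P ** dup I) †) ** ⟨ ∼ e ⟩ₜ)
  conseq : ∀ {U U' s P P'} → U ⊨ₐ U' → TH U' s P' → P' ⊨ₜ P → TH U s P
  exists : ∀ {s} (A : Set) (U : A → Assn) (P : A → TPred) →
           (∀ z → TH (U z) s (P z)) → TH (∃ₐ A U) s (∃ₜ A P)

data SH : Assn → Stmt → Assn → Set₁ where
  assign : ∀ {U x e} → SH (U [ e / x ]) (x ≔ e) U
  skip   : ∀ {U} → SH U skip U
  seq    : ∀ {U V Z s₀ s₁} → SH U s₀ V → SH V s₁ Z → SH U (s₀ ⨾ s₁) Z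
  if     : ∀ {U Z e sₜ s_f} →
           SH (⌜ e ⌝ ∧ₐ U) sₜ Z → SH ((∼ e) ∧ₐ U) s_f Z →
           SH U (If e Then sₜ Else s_f) Z
  while-fun : ∀ {I : Assn} {e : Expr} {sₜ : Stmt} (t : State → ℕ) (m : ℕ) →
           (∀ (n : ℕ) → SH (λ σ → σ ⊨ e × I σ × t σ ≡ n) sₜ (λ σ → I σ × t σ < n)) →
           SH (λ σ → I σ × t σ ≡ m) (While e Do sₜ) (λ σ → I σ × t σ ≤ m × ¬ (σ ⊨ e))
  exists : ∀ {s} (A : Set) (U V : A → Assn) →
           (∀ z → SH (U z) s (V z)) → SH (∃ₐ A U) s (∃ₐ A V)
  conseq : ∀ {U U' s Z Z'} → U ⊨ₐ U' → SH U' s Z' → Z' ⊨ₐ Z → SH U s Z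

module Submission where

-- A derivation of {U} s {Z} in the state-based total-correctness logic is
-- translated, by induction on the derivation, into a trace-based derivation
-- whose postcondition  Halts W Z  says: the trace is finite, ends in a
-- Z-state, and starts in a W-state.  The auxiliary predicate W is added to
-- the precondition and "frozen" into the postcondition; it is what allows a
-- loop body to remember the initial value n of the variant t and so to
-- produce traces along which t decreases.

open import Defs
open import Level using (Lift; lift; lower) renaming (suc to lsuc; zero to lzero)
open import Data.Nat using (ℕ; zero; suc; _<_; _≤_)
open import Data.Nat.Properties using (≤-reflexive; ≤-refl; ≤-trans; <-≤-trans; <⇒≤; ≤-pred)
open import Data.Maybe.Properties using (just-injective)
open import Data.Product using (Σ; _×_; _,_; proj₂)
open import Data.Sum using (inj₁; inj₂)
open import Data.Unit using (⊤; tt)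
open import Data.Empty using (⊥-elim)
open import Relation.Nullary using (¬_)
open import Relation.Binary.PropositionalEquality using (_≡_; refl; sym; trans; subst)

⊤ₐ : Assn
⊤ₐ _ = ⊤

cons-tail : ∀ {σ σ' t t'} → (σ ∷ t) ≈ (σ' ∷ t') → t ≈ t'
cons-tail (bisim _ tl≈') = bisim (just-injective (tl≈' 0)) (λ n → tl≈' (suc n))

nil≉cons : ∀ {σ σ' t} → ¬ (⟨ σ ⟩ ≈ (σ' ∷ t))
nil≉cons (bisim _ tl≈') with tl≈' 0
... | ()

↓-pair : ∀ {τ σ σ'} → τ ≈ (σ ∷ ⟨ σ' ⟩) → τ ↓ σ'
↓-pair p = ↓-cons p (↓-nil ≈-refl)

_⇓_ : Trace → Assn → Set
τ ⇓ Z = Σ State (λ σ → τ ↓ σ × Z σ)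

⇓-inv : ∀ {Z τ τ'} → τ ≈ τ' → τ ⇓ Z → τ' ⇓ Z
⇓-inv e (σ , d , z) = σ , ↓-inv e d , z

⇓-mono : ∀ {Z Z' τ} → Z ⊨ₐ Z' → τ ⇓ Z → τ ⇓ Z'
⇓-mono ZZ' (σ , d , z) = σ , d , ZZ' σ z

follows-hd : ∀ {ℓ} {Q : Trace → Set ℓ} {τ τ'} → Follows Q τ τ' → hd τ ≡ hd τ'
follows-hd (R , post , r) with post _ _ r
... | inj₁ (_ , a , b , _) = trans (hd≈ a) (sym b)
... | inj₂ (_ , _ , _ , a , b , _) = trans (hd≈ a) (sym (hd≈ b))

-- Induction on τ ↓ σ, carrying a bisimulation up to which the
-- post-fixed point R is applied.
follows-⇓ : ∀ {ℓ} {Q : Trace → Set ℓ} {V Z : Assn} {τ τ'} →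
  τ ⇓ V → Follows Q τ τ' → (∀ {T} → Q T → V (hd T) → T ⇓ Z) → τ' ⇓ Z
follows-⇓ {Q = Q} {V} {Z} (σ , d , v) (R , post , r) continue = go d ≈-refl r
  where
  go : ∀ {τ τ₀ τ'} → τ ↓ σ → τ₀ ≈ τ → R τ₀ τ' → τ' ⇓ Z
  go (↓-nil p) e r with post _ _ r
  ... | inj₁ (_ , a , b , q) = continue q (subst V endpoint v)
    where
    endpoint : σ ≡ _
    endpoint = trans (sym (hd≈ (≈-trans e p))) (trans (hd≈ a) (sym b))
  ... | inj₂ (_ , _ , _ , a , _ , _) = ⊥-elim (nil≉cons (≈-trans (≈-sym (≈-trans e p)) a))
  go (↓-cons p d) e r with post _ _ r
  ... | inj₁ (_ , a , _ , _) = ⊥-elim (nil≉cons (≈-trans (≈-sym a) (≈-trans e p)))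
  ... | inj₂ (_ , _ , _ , a , b , r') with go d (cons-tail (≈-trans (≈-sym a) (≈-trans e p))) r'
  ... | (σ' , d' , z) = σ' , ↓-cons b d' , z

-- A finite trace ending in a Z-state follows itself under ⟨Z⟩: the
-- relation "bisimilar and ending in σ" is a post-fixed point.
follows-self : ∀ {Z : Assn} {τ σ} → τ ↓ σ → Z σ → Follows (pred ⟨ Z ⟩ₜ) τ τ
follows-self {Z} {τ} {σ} d z = R , post , (≈-refl , d)
  where
  R : Trace → Trace → Set
  R a b = a ≈ b × a ↓ σ
  post : ∀ a b → R a b → FollowsStep (pred ⟨ Z ⟩ₜ) R a b
  post a b (ab , ↓-nil p) =
    inj₁ (σ , p , trans (sym (hd≈ ab)) (hd≈ p) , lift (σ , z , ≈-trans (≈-sym ab) p))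
  post a b (ab , ↓-cons {σ'} {τ'} p d') =
    inj₂ (σ' , τ' , τ' , p , ≈-trans (≈-sym ab) p , (≈-refl , d'))

⇓-** : ∀ {P Z T} → pred P T → T ⇓ Z → pred (P ** ⟨ Z ⟩ₜ) T
⇓-** p (_ , d , z) = _ , p , follows-self d z

**-head : ∀ {P Q} {W : Assn} → (∀ {τ} → pred P τ → W (hd τ)) →
  ∀ {T} → pred (P ** Q) T → W (hd T)
**-head {W = W} head (_ , p , f) = subst W (follows-hd f) (head p)

-- Terminates U P Z : every P-trace starting in a U-state ends in a Z-state.
-- (A record rather than a bare Π-type, so that U, P and Z are inferable.)
record Terminates (U : Assn) (P : TPred) (Z : Assn) : Set₁ where
  constructor terminates
  field run : ∀ {τ} → pred P τ → U (hd τ) → τ ⇓ Z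
open Terminates

terminates-conseq : ∀ {U U' P Z Z'} →
  U ⊨ₐ U' → Terminates U' P Z' → Z' ⊨ₐ Z → Terminates U P Z
terminates-conseq UU' term Z'Z = terminates λ p u → ⇓-mono Z'Z (run term p (UU' _ u))

⟨⟩-terminates : ∀ {U V} → Terminates U ⟨ V ⟩ₜ (U ∧ₐ V)
⟨⟩-terminates {U} = terminates λ (lift (σ , v , p)) u → σ , ↓-nil p , subst U (hd≈ p) u , v

dup-terminates : ∀ {U V} → Terminates U (dup V) (U ∧ₐ V)
dup-terminates {U} = terminates λ (lift (σ , v , p)) u → σ , ↓-pair p , subst U (hd≈ p) u , v

**-terminates : ∀ {U V Z P Q} →
  Terminates U P V → Terminates V Q Z → Terminates U (P ** Q) Z
**-terminates {U} termP termQ = terminates λ (_ , p , f) u →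
  follows-⇓ (run termP p (subst U (sym (follows-hd f)) u)) f (run termQ)

Halts : Assn → Assn → TPred
Halts W Z = record
  { pred = λ T → Lift (lsuc lzero) (W (hd T) × T ⇓ Z)
  ; inv  = λ e (lift (w , t)) → lift (subst W (hd≈ e) w , ⇓-inv e t) }

halts-terminates : ∀ {U W Z} → Terminates U (Halts W Z) Z
halts-terminates = terminates λ (lift (_ , t)) _ → t

halts-mono : ∀ {W Z Z'} → Z ⊨ₐ Z' → Halts W Z ⊨ₜ Halts W Z'
halts-mono ZZ' _ (lift (w , t)) = lift (w , ⇓-mono ZZ' t)

halts-from : ∀ {P Q} {W Z : Assn} → (∀ {τ} → pred P τ → W (hd τ)) →
  Terminates ⊤ₐ (P ** Q) Z → (P ** Q) ⊨ₜ Halts W Z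
halts-from {P} {Q} {W} head term _ h = lift (**-head {P} {Q} {W} head h , run term h tt)

dup-head : ∀ {U τ} → pred (dup U) τ → U (hd τ)
dup-head {U} (lift (σ , u , p)) = subst U (sym (hd≈ p)) u

-- Decreasing f : finite traces whose final f-value is below the initial one;
-- the trace predicate describing one run of a loop body.
Decreasing : (State → ℕ) → TPred
Decreasing f = ∃ₜ ℕ (λ n → Halts (λ σ → f σ ≡ n) (λ σ → f σ < n))

below : (State → ℕ) → ℕ → Assn
below f k σ = f σ < k

decreasing-terminates : ∀ f k → Terminates (below f (suc k)) (Decreasing f) (below f k)
decreasing-terminates f k = terminates λ (n , lift (fn , σ , d , lt)) fk →
  σ , d , <-≤-trans lt (≤-pred (subst (_< suc k) fn fk))

-- Induction on a bound k for the variant: an iteration either stops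
-- (⟨true⟩ clause) or runs one f-decreasing body to a J-state, from where the
-- remaining iterations start with a smaller variant.
module Iteration (f : State → ℕ) (J : Assn) where
  Step : TPred
  Step = Decreasing f ** dup J

  step-terminates : ∀ k → Terminates (below f (suc k)) Step (below f k ∧ₐ J)
  step-terminates k = **-terminates (decreasing-terminates f k) (dup-terminates {below f k} {J})

  iterate-⇓ : ∀ k {X} → (∀ t → X t → DagStep Step X t) →
    ∀ {τ} → X τ → (below f k ∧ₐ J) (hd τ) → τ ⇓ J
  iterate-⇓ zero post x (() , _)
  iterate-⇓ (suc k) post {τ} x (fk , j) with post τ x
  ... | inj₁ (lift (σ , p)) = σ , ↓-nil p , subst J (hd≈ p) j
  ... | inj₂ (_ , step , f') =
    follows-⇓ (run (step-terminates k) step (subst (below f (suc k)) (sym (follows-hd f')) fk))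
              f' (iterate-⇓ k post)

  iteration-terminates : Terminates J (Step †) J
  iteration-terminates = terminates λ {τ} (X , post , x) j →
    iterate-⇓ (suc (f (hd τ))) post x (≤-refl , j)

-- The loop
-- invariant is I' = I ∧ f ≤ m; the body is run with W := (f = n), which
-- makes its traces f-decreasing, so the iteration terminates.
module Loop {I : Assn} {e : Expr} {sₜ : Stmt} (f : State → ℕ) (m : ℕ)
  (body : ∀ n (W : Assn) →
    TH ((λ σ → σ ⊨ e × I σ × f σ ≡ n) ∧ₐ W) sₜ (Halts W (λ σ → I σ × f σ < n)))
  where
  I' : Assn
  I' σ = I σ × f σ ≤ m
  open Iteration f I'

  -- variants that can occur inside the loop
  Bounded : Set
  Bounded = Σ ℕ (_≤ m)

  bodyPre : Bounded → Assn
  bodyPre (n , _) = (λ σ → σ ⊨ e × I σ × f σ ≡ n) ∧ₐ (λ σ → f σ ≡ n)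

  bodyPost : Bounded → TPred
  bodyPost (n , _) = Halts (λ σ → f σ ≡ n) (λ σ → I σ × f σ < n)

  pickVariant : (⌜ e ⌝ ∧ₐ I') ⊨ₐ ∃ₐ Bounded bodyPre
  pickVariant σ (ev , i , le) = (f σ , le) , (ev , i , refl) , refl

  decreases : ∃ₜ Bounded bodyPost ⊨ₜ (Decreasing f ** ⟨ I' ⟩ₜ)
  decreases _ ((n , n≤m) , lift (fn , σ , d , (i , lt))) =
    ⇓-** {Decreasing f} (n , lift (fn , σ , d , lt)) (σ , d , i , ≤-trans (<⇒≤ lt) n≤m)

  loopBody : TH (⌜ e ⌝ ∧ₐ I') sₜ (Decreasing f ** ⟨ I' ⟩ₜ)
  loopBody = conseq pickVariant
    (exists Bounded bodyPre bodyPost (λ (n , _) → body n (λ σ → f σ ≡ n)))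
    decreases

  module _ (W : Assn) where
    Start : Assn
    Start = (λ σ → I σ × f σ ≡ m) ∧ₐ W

    entry : Start ⊨ₐ I'
    entry _ ((i , fm) , _) = i , ≤-reflexive fm

    iterations : Terminates (⊤ₐ ∧ₐ Start) (Step †) I'
    iterations = terminates-conseq (λ _ (_ , u) → entry _ u) iteration-terminates (λ _ j → j)

    runsToExit : Terminates ⊤ₐ (dup Start ** (Step †) ** ⟨ ∼ e ⟩ₜ) (I' ∧ₐ (∼ e))
    runsToExit = **-terminates dup-terminates (**-terminates iterations ⟨⟩-terminates)

    exit : (dup Start ** (Step †) ** ⟨ ∼ e ⟩ₜ) ⊨ₜ Halts W (λ σ → I σ × f σ ≤ m × ¬ (σ ⊨ e))
    exit = halts-from {dup Start} {(Step †) ** ⟨ ∼ e ⟩ₜ} {W} (λ h → proj₂ (dup-head h))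
      (terminates-conseq (λ _ u → u) runsToExit (λ _ ((i , le) , ne) → i , le , ne))

    loop : TH Start (While e Do sₜ) (Halts W (λ σ → I σ × f σ ≤ m × ¬ (σ ⊨ e)))
    loop = conseq (λ _ u → u) (while {P = Decreasing f} entry loopBody) exit

total→trace : ∀ {U s Z} → SH U s Z → (W : Assn) → TH (U ∧ₐ W) s (Halts W Z)
total→trace (assign {U} {x} {e}) W = conseq (λ _ u → u) assign post
  where
  post : (((U [ e / x ]) ∧ₐ W) [ x ↦ₜ e ]) ⊨ₜ Halts W U
  post T (lift (σ , (u , w) , p)) = lift (subst W (sym (hd≈ p)) w , _ , ↓-pair p , u)
total→trace (skip {U}) W = conseq (λ _ u → u) skip post
  where
  post : ⟨ U ∧ₐ W ⟩ₜ ⊨ₜ Halts W U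
  post T (lift (σ , (u , w) , p)) = lift (subst W (sym (hd≈ p)) w , σ , ↓-nil p , u)
total→trace (seq {V = V} {Z = Z} d₀ d₁) W =
  conseq (λ _ u → u)
    (seq {P = Halts W V} {Q = Halts ⊤ₐ Z}
      (conseq (λ _ u → u) (total→trace d₀ W) (λ _ h → ⇓-** {Halts W V} h (proj₂ (lower h))))
      (conseq (λ _ v → v , tt) (total→trace d₁ ⊤ₐ) (λ _ h → h)))
    (halts-from {Halts W V} {Halts ⊤ₐ Z} {W} (λ (lift (w , _)) → w)
      (**-terminates (halts-terminates {⊤ₐ}) (halts-terminates {V})))
total→trace (if {U} {Z} dₜ d_f) W =
  conseq (λ _ u → u)
    (if {P = Halts W Z} (conseq (λ _ (ev , u , w) → (ev , u) , w) (total→trace dₜ W) (λ _ h → h))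
                        (conseq (λ _ (ne , u , w) → (ne , u) , w) (total→trace d_f W) (λ _ h → h)))
    (halts-from {dup (U ∧ₐ W)} {Halts W Z} {W} (λ h → proj₂ (dup-head h))
      (**-terminates (dup-terminates {⊤ₐ}) (halts-terminates {⊤ₐ ∧ₐ (U ∧ₐ W)})))
total→trace (while-fun f m body) W = Loop.loop f m (λ n → total→trace (body n)) W
total→trace (exists A U V ds) W =
  conseq (λ _ ((z , u) , w) → z , u , w)
    (exists A (λ z → U z ∧ₐ W) (λ z → Halts W (V z)) (λ z → total→trace (ds z) W))
    (λ T (z , h) → halts-mono {W} {V z} (λ _ v → z , v) T h)
total→trace (conseq UU' d Z'Z) W =
  conseq (λ σ (u , w) → UU' σ u , w) (total→trace d W) (halts-mono Z'Z)

corollary4p3 : ∀ {s : Stmt} {U Z : Assn} → SH U s Z → TH U s (finite ** ⟨ Z ⟩ₜ)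
corollary4p3 d =
  conseq (λ _ u → u , tt) (total→trace d ⊤ₐ)
    (λ _ (lift (_ , (σ , end , z))) → ⇓-** {finite} (lift (σ , end)) (σ , end , z))
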